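{- Consider Girard's system F over the base types $e_1,\dots,e_n,t$, together with constants $c_{ij}:e_i\to e_j$ for a given set of base coercions which is transitive and acyclic, has at most one coercion between any two base types, and satisfies $c_{jk}\circ c_{ij}=c_{ik}$. Consider the term-annotated coercive subtyping system whose judgements have the form $x:A<s:B$, whose axioms are $x:e_i<c_{ij}(x):e_j$ for each base coercion constant, and whose rules are: (transitivity) from $x:A<t:B$ and $y:B<u:C$ derive $x:A<u[y:=t]:C$; (arrow, both sides) from $x:A<t:B$ and $z:C<u:D$ derive $f:D\to A<\lambda z^C.\,t[x:=f(u)]:C\to B$; (arrow, covariant) from $x:A<t:B$ derive $f:T\to A<\lambda w^T.\,t[x:=f(w)]:T\to B$; (arrow, contravariant) from $x:A<t:B$ derive $g:B\to T<\lambda x^A.\,g(t):A\to T$; (type-quantifier introduction) from $u:U<t:T[X]$ derive $u:U<\Lambda X.\,t:\Pi X.\,T[X]$, provided $X$ is not free in $U$; (type-quantifier elimination) from $u:U<t:\Pi X.\,T[X]$ derive $u:U<t\{W\}:T[W]$. Let $x:e_i<\tilde{\mathcal C}:e_j$ be derivable in this system for base types $e_i,e_j$. Then the ($\beta$-normal, $\eta$-long) normal form $\mathcal C$ of $\tilde{\mathcal C}$ is a compound of the constants $c_{kl}$ applied to $x$, i.e. it belongs to the smallest set $C_i$ containing $x^{e_i}$ and containing $c_{jk}(c)$ of type $e_k$ whenever it contains $c$ of type $e_j$; and consequently, by the assumptions on the base coercions, it is (equal to) a single base coercion applied to $x$, namely the coercion from $e_i$ to $e_j$.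
   Context: System F types: base types $e_1,\dots,e_n$ (sorts of entities) and $t$ (propositions), type variables, $\Pi\alpha.\,T$, and $T_1\to T_2$. Terms: variables and constants, application, $\lambda$-abstraction, type application $\tau\{U\}$ and type abstraction $\Lambda\alpha.\,\tau$; reduction is $\beta$-reduction $(\lambda x.\tau)u\to\tau[u/x]$ together with $(\Lambda\alpha.\tau)\{U\}\to\tau[U/\alpha]$, which is strongly normalising and confluent. The judgement $A<B$ means "$A$ is a (coercive) subtype of $B$", and the term on the right is the coercion witnessing it. -}

module Defs where

open import Data.Nat using (ℕ; zero; suc)
open import Data.Fin using (Fin; zero; suc)
open import Data.Product using (Σ; _×_)
open import Data.Sum using (_⊎_)
open import Relation.Nullary using (¬_)
open import Relation.Binary.PropositionalEquality using (_≡_)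
open import Relation.Binary.Construct.Closure.ReflexiveTransitive using (Star)
open import Relation.Binary.Construct.Closure.Transitive using (TransClosure)

-- Hypotheses on the set of base coercions (a relation on the base sorts e₁..eₙ).
-- Coe i j is inhabited iff there is a base coercion constant c_ij : e_i → e_j.
module _ {n : ℕ} (Coe : Fin n → Fin n → Set) where
  IsTransitive : Set
  IsTransitive = ∀ {i j l} → Coe i j → Coe j l → Coe i l

  IsAcyclic : Set
  IsAcyclic = ∀ {i} → ¬ TransClosure Coe i i

  AtMostOne : Set
  AtMostOne = ∀ {i j} (p q : Coe i j) → p ≡ q

module System (n : ℕ) (Coe : Fin n → Fin n → Set) where

  data Ty (k : ℕ) : Set where
    tv   : Fin k → Ty k
    base : Fin n → Ty k
    prop : Ty k                  -- t
    _⇒_  : Ty k → Ty k → Ty k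
    Π    : Ty (suc k) → Ty k

  infixr 7 _⇒_

  liftR : ∀ {a b} → (Fin a → Fin b) → Fin (suc a) → Fin (suc b)
  liftR ρ zero = zero
  liftR ρ (suc x) = suc (ρ x)

  tren : ∀ {k k'} → (Fin k → Fin k') → Ty k → Ty k'
  tren ρ (tv x) = tv (ρ x)
  tren ρ (base i) = base i
  tren ρ prop = prop
  tren ρ (A ⇒ B) = tren ρ A ⇒ tren ρ B
  tren ρ (Π A) = Π (tren (liftR ρ) A)

  liftTS : ∀ {k k'} → (Fin k → Ty k') → Fin (suc k) → Ty (suc k')
  liftTS σ zero = tv zero
  liftTS σ (suc x) = tren suc (σ x)

  tsub : ∀ {k k'} → (Fin k → Ty k') → Ty k → Ty k'
  tsub σ (tv x) = σ x
  tsub σ (base i) = base i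
  tsub σ prop = prop
  tsub σ (A ⇒ B) = tsub σ A ⇒ tsub σ B
  tsub σ (Π A) = Π (tsub (liftTS σ) A)

  singleT : ∀ {k} → Ty k → Fin (suc k) → Ty k
  singleT W zero = W
  singleT W (suc x) = tv x

  -- T[W] for T with the bound variable X = index 0
  _[_]T : ∀ {k} → Ty (suc k) → Ty k → Ty k
  T [ W ]T = tsub (singleT W) T

  -- weakening of a type by a fresh type variable (so X is not free in it)
  wkT : ∀ {k} → Ty k → Ty (suc k)
  wkT = tren suc

  -- terms with k free type variables and m free term variables
  data Tm : ℕ → ℕ → Set where
    var   : ∀ {k m} → Fin m → Tm k m
    con   : ∀ {k m i j} → Coe i j → Tm k m
    _·_   : ∀ {k m} → Tm k m → Tm k m → Tm k m
    ƛ     : ∀ {k m} → Ty k → Tm k (suc m) → Tm k m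
    _﹛_﹜ : ∀ {k m} → Tm k m → Ty k → Tm k m
    Λ     : ∀ {k m} → Tm (suc k) m → Tm k m

  infixl 8 _·_

  ttren : ∀ {k k' m} → (Fin k → Fin k') → Tm k m → Tm k' m
  ttren ρ (var x) = var x
  ttren ρ (con p) = con p
  ttren ρ (t · u) = ttren ρ t · ttren ρ u
  ttren ρ (ƛ A t) = ƛ (tren ρ A) (ttren ρ t)
  ttren ρ (t ﹛ U ﹜) = ttren ρ t ﹛ tren ρ U ﹜
  ttren ρ (Λ t) = Λ (ttren (liftR ρ) t)

  ttsub : ∀ {k k' m} → (Fin k → Ty k') → Tm k m → Tm k' m
  ttsub σ (var x) = var x
  ttsub σ (con p) = con p
  ttsub σ (t · u) = ttsub σ t · ttsub σ u
  ttsub σ (ƛ A t) = ƛ (tsub σ A) (ttsub σ t)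
  ttsub σ (t ﹛ U ﹜) = ttsub σ t ﹛ tsub σ U ﹜
  ttsub σ (Λ t) = Λ (ttsub (liftTS σ) t)

  ren : ∀ {k m m'} → (Fin m → Fin m') → Tm k m → Tm k m'
  ren ρ (var x) = var (ρ x)
  ren ρ (con p) = con p
  ren ρ (t · u) = ren ρ t · ren ρ u
  ren ρ (ƛ A t) = ƛ A (ren (liftR ρ) t)
  ren ρ (t ﹛ U ﹜) = ren ρ t ﹛ U ﹜
  ren ρ (Λ t) = Λ (ren ρ t)

  liftS : ∀ {k m m'} → (Fin m → Tm k m') → Fin (suc m) → Tm k (suc m')
  liftS σ zero = var zero
  liftS σ (suc x) = ren suc (σ x)

  sub : ∀ {k m m'} → (Fin m → Tm k m') → Tm k m → Tm k m'
  sub σ (var x) = σ x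
  sub σ (con p) = con p
  sub σ (t · u) = sub σ t · sub σ u
  sub σ (ƛ A t) = ƛ A (sub (liftS σ) t)
  sub σ (t ﹛ U ﹜) = sub σ t ﹛ U ﹜
  sub σ (Λ t) = Λ (sub (λ x → ttren suc (σ x)) t)

  single : ∀ {k m} → Tm k m → Fin (suc m) → Tm k m
  single u zero = u
  single u (suc x) = var x

  infix 4 _⟶_
  data _⟶_ : ∀ {k m} → Tm k m → Tm k m → Set where
    β     : ∀ {k m} {A : Ty k} {t : Tm k (suc m)} {u : Tm k m} →
            ƛ A t · u ⟶ sub (single u) t
    βΛ    : ∀ {k m} {t : Tm (suc k) m} {U : Ty k} →
            Λ t ﹛ U ﹜ ⟶ ttsub (singleT U) t
    appˡ  : ∀ {k m} {t t' u : Tm k m} → t ⟶ t' → t · u ⟶ t' · u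
    appʳ  : ∀ {k m} {t u u' : Tm k m} → u ⟶ u' → t · u ⟶ t · u'
    lam   : ∀ {k m} {A : Ty k} {t t' : Tm k (suc m)} → t ⟶ t' → ƛ A t ⟶ ƛ A t'
    tapp  : ∀ {k m} {t t' : Tm k m} {U : Ty k} → t ⟶ t' → t ﹛ U ﹜ ⟶ t' ﹛ U ﹜
    tlam  : ∀ {k m} {t t' : Tm (suc k) m} → t ⟶ t' → Λ t ⟶ Λ t'

  infix 4 _⟶*_
  _⟶*_ : ∀ {k m} → Tm k m → Tm k m → Set
  _⟶*_ = Star _⟶_

  Normal : ∀ {k m} → Tm k m → Set
  Normal t = ∀ {t'} → ¬ (t ⟶ t')

  -- The term s has exactly one free term variable (index 0) = x.
  -- In binder bodies (scope 2): index 0 = the λ-bound variable, index 1 = the new free variable.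
  x₀ : ∀ {k} → Tm k 1
  x₀ = var zero

  infix 3 _≺_∶_
  data _≺_∶_ : ∀ {k} → Ty k → Tm k 1 → Ty k → Set where
    ax     : ∀ {k i j} (p : Coe i j) → base {k} i ≺ con p · x₀ ∶ base j
    trans≺ : ∀ {k} {A B C : Ty k} {t u : Tm k 1} →
             A ≺ t ∶ B → B ≺ u ∶ C → A ≺ sub (λ _ → t) u ∶ C
    arr    : ∀ {k} {A B C D : Ty k} {t u : Tm k 1} →
             A ≺ t ∶ B → C ≺ u ∶ D →
             D ⇒ A ≺ ƛ C (sub (λ _ → var (suc zero) · sub (λ _ → var zero) u) t) ∶ C ⇒ B
    arrCo  : ∀ {k} {A B T : Ty k} {t : Tm k 1} →
             A ≺ t ∶ B →
             T ⇒ A ≺ ƛ T (sub (λ _ → var (suc zero) · var zero) t) ∶ T ⇒ B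
    arrContra : ∀ {k} {A B T : Ty k} {t : Tm k 1} →
             A ≺ t ∶ B →
             B ⇒ T ≺ ƛ A (var (suc zero) · sub (λ _ → var zero) t) ∶ A ⇒ T
    ΠI     : ∀ {k} {U : Ty k} {T : Ty (suc k)} {t : Tm (suc k) 1} →
             wkT U ≺ t ∶ T → U ≺ Λ t ∶ Π T
    ΠE     : ∀ {k} {U : Ty k} {T : Ty (suc k)} {t : Tm k 1} (W : Ty k) →
             U ≺ t ∶ Π T → U ≺ t ﹛ W ﹜ ∶ T [ W ]T

  -- C_i : smallest set containing x^{e_i} and closed under c ↦ c_jl(c);
  -- Compound i j s : s ∈ C_i and s has type e_j.
  data Compound {k} (i : Fin n) : Fin n → Tm k 1 → Set where
    cx : Compound i i x₀
    cc : ∀ {j l} {c : Tm k 1} → Compound i j c → (p : Coe j l) → Compound i l (con p · c)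

  infix 4 _≈_
  data _≈_ : ∀ {k m} → Tm k m → Tm k m → Set where
    ≈-refl  : ∀ {k m} {t : Tm k m} → t ≈ t
    ≈-sym   : ∀ {k m} {t u : Tm k m} → t ≈ u → u ≈ t
    ≈-trans : ∀ {k m} {t u v : Tm k m} → t ≈ u → u ≈ v → t ≈ v
    ≈-comp  : ∀ {k m i j l} (p : Coe i j) (q : Coe j l) (r : Coe i l) (s : Tm k m) →
              con q · (con p · s) ≈ con r · s
    ≈-app   : ∀ {k m} {t t' u u' : Tm k m} → t ≈ t' → u ≈ u' → t · u ≈ t' · u'
    ≈-lam   : ∀ {k m} {A : Ty k} {t t' : Tm k (suc m)} → t ≈ t' → ƛ A t ≈ ƛ A t'
    ≈-tapp  : ∀ {k m} {t t' : Tm k m} {U : Ty k} → t ≈ t' → t ﹛ U ﹜ ≈ t' ﹛ U ﹜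
    ≈-tlam  : ∀ {k m} {t t' : Tm (suc k) m} → t ≈ t' → Λ t ≈ Λ t'

module Submission where

-- The source of a derivable judgement is never a Π-type, so a transitivity step out of
-- e_i passes through a base type and the arrow rules never fire. Hence the coercion term
-- is built from x by applying constants, Λ-abstracting and instantiating, the Λs mirroring
-- the quantifiers of the target. This shape survives β-reduction, and a normal form of base
-- shape contains no Λ, so it is a compound of constants; transitivity of the base coercions
-- and c_jl ∘ c_ij = c_il collapse it to one constant.

open import Defs
open import Data.Nat using (ℕ; zero; suc)
open import Data.Fin using (Fin; zero; suc)
open import Data.Product using (Σ; ∃; _×_; _,_)
open import Data.Sum using (_⊎_; inj₁; inj₂)
open import Data.Empty using (⊥-elim)
open import Relation.Nullary using (¬_)
open import Relation.Binary.PropositionalEquality using (_≡_; refl)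
open import Relation.Binary.Construct.Closure.ReflexiveTransitive using (ε; _◅_)

module Coercions (n : ℕ) (Coe : Fin n → Fin n → Set) where
  open System n Coe

  -- Types of the form Π X₁ … Π Xₘ. e_j, forgetting the bound variables.
  data Shape : Set where
    ι  : Fin n → Shape
    Πˢ : Shape → Shape

  data _HasShape_ {k} : Ty k → Shape → Set where
    base : ∀ {j} → base j HasShape ι j
    Π    : ∀ {T s} → T HasShape s → Π T HasShape Πˢ s

  tsub-HasShape : ∀ {k k'} (σ : Fin k → Ty k') {T s} → T HasShape s → tsub σ T HasShape s
  tsub-HasShape σ base  = base
  tsub-HasShape σ (Π h) = Π (tsub-HasShape (liftTS σ) h)

  data CoeTm {k} (i : Fin n) : Shape → Tm k 1 → Set where
    c-var  : CoeTm i (ι i) x₀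
    c-con  : ∀ {j l t} → CoeTm i (ι j) t → (p : Coe j l) → CoeTm i (ι l) (con p · t)
    c-Λ    : ∀ {s} {t : Tm (suc k) 1} → CoeTm i s t → CoeTm i (Πˢ s) (Λ t)
    c-inst : ∀ {s t} {U : Ty k} → CoeTm i (Πˢ s) t → CoeTm i s (t ﹛ U ﹜)

  CoeTm-ttren : ∀ {k k' i s} (ρ : Fin k → Fin k') {t} → CoeTm i s t → CoeTm i s (ttren ρ t)
  CoeTm-ttren ρ c-var       = c-var
  CoeTm-ttren ρ (c-con c p) = c-con (CoeTm-ttren ρ c) p
  CoeTm-ttren ρ (c-Λ c)     = c-Λ (CoeTm-ttren (liftR ρ) c)
  CoeTm-ttren ρ (c-inst c)  = c-inst (CoeTm-ttren ρ c)

  CoeTm-ttsub : ∀ {k k' i s} (σ : Fin k → Ty k') {t} → CoeTm i s t → CoeTm i s (ttsub σ t)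
  CoeTm-ttsub σ c-var       = c-var
  CoeTm-ttsub σ (c-con c p) = c-con (CoeTm-ttsub σ c) p
  CoeTm-ttsub σ (c-Λ c)     = c-Λ (CoeTm-ttsub (liftTS σ) c)
  CoeTm-ttsub σ (c-inst c)  = c-inst (CoeTm-ttsub σ c)

  CoeTm-sub : ∀ {k i j s} (σ : Fin 1 → Tm k 1) {u} →
              CoeTm i (ι j) (σ zero) → CoeTm j s u → CoeTm i s (sub σ u)
  CoeTm-sub σ c c-var        = c
  CoeTm-sub σ c (c-con c' p) = c-con (CoeTm-sub σ c c') p
  CoeTm-sub σ c (c-Λ c')     = c-Λ (CoeTm-sub (λ x → ttren suc (σ x)) (CoeTm-ttren suc c) c')
  CoeTm-sub σ c (c-inst c')  = c-inst (CoeTm-sub σ c c')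

  source-not-Π : ∀ {k} {T : Ty (suc k)} {B : Ty k} {t} → ¬ (Π T ≺ t ∶ B)
  source-not-Π (trans≺ d _) = source-not-Π d
  source-not-Π (ΠI d)       = source-not-Π d
  source-not-Π (ΠE _ d)     = source-not-Π d

  ≺-from-base : ∀ {k i} {B : Ty k} {t} → base i ≺ t ∶ B → ∃ λ s → CoeTm i s t × B HasShape s
  ≺-from-base (ax p) = ι _ , c-con c-var p , base
  ≺-from-base (trans≺ d e) with ≺-from-base d
  ... | Πˢ _ , _ , Π _ = ⊥-elim (source-not-Π e)
  ... | ι _  , c , base with ≺-from-base e
  ...   | s , c' , h = s , CoeTm-sub _ c c' , h
  ≺-from-base (ΠI d) with ≺-from-base d
  ... | s , c , h = Πˢ s , c-Λ c , Π h
  ≺-from-base (ΠE W d) with ≺-from-base d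
  ... | Πˢ s , c , Π h = s , c-inst c , tsub-HasShape (singleT W) h

  ≺-between-bases : ∀ {k i j} {t : Tm k 1} → base i ≺ t ∶ base j → CoeTm i (ι j) t
  ≺-between-bases d with ≺-from-base d
  ... | _ , c , base = c

  CoeTm-⟶ : ∀ {k i s} {t t' : Tm k 1} → CoeTm i s t → t ⟶ t' → CoeTm i s t'
  CoeTm-⟶ (c-con c p)      (appʳ r) = c-con (CoeTm-⟶ c r) p
  CoeTm-⟶ (c-Λ c)          (tlam r) = c-Λ (CoeTm-⟶ c r)
  CoeTm-⟶ (c-inst (c-Λ c)) βΛ       = CoeTm-ttsub _ c
  CoeTm-⟶ (c-inst c)       (tapp r) = c-inst (CoeTm-⟶ c r)

  CoeTm-⟶* : ∀ {k i s} {t t' : Tm k 1} → CoeTm i s t → t ⟶* t' → CoeTm i s t'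
  CoeTm-⟶* c ε        = c
  CoeTm-⟶* c (r ◅ rs) = CoeTm-⟶* (CoeTm-⟶ c r) rs

  normal-CoeTm-Π⇒Λ : ∀ {k i s} {t : Tm k 1} → CoeTm i (Πˢ s) t → Normal t →
                     ∃ λ (t₁ : Tm (suc k) 1) → t ≡ Λ t₁
  normal-CoeTm-Π⇒Λ (c-Λ c) _ = _ , refl
  normal-CoeTm-Π⇒Λ (c-inst c) nf with normal-CoeTm-Π⇒Λ c (λ r → nf (tapp r))
  ... | _ , refl = ⊥-elim (nf βΛ)

  normal-CoeTm⇒Compound : ∀ {k i j} {t : Tm k 1} → CoeTm i (ι j) t → Normal t → Compound i j t
  normal-CoeTm⇒Compound c-var _ = cx
  normal-CoeTm⇒Compound (c-con c p) nf = cc (normal-CoeTm⇒Compound c (λ r → nf (appʳ r))) p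
  normal-CoeTm⇒Compound (c-inst c) nf with normal-CoeTm-Π⇒Λ c (λ r → nf (tapp r))
  ... | _ , refl = ⊥-elim (nf βΛ)

  Compound-collapse : IsTransitive Coe → ∀ {k i j} {t : Tm k 1} → Compound i j t →
                      (i ≡ j × t ≡ x₀) ⊎ Σ (Coe i j) (λ p → t ≈ con p · x₀)
  Compound-collapse trans cx = inj₁ (refl , refl)
  Compound-collapse trans (cc c q) with Compound-collapse trans c
  ... | inj₁ (refl , refl) = inj₂ (q , ≈-refl)
  ... | inj₂ (p , t≈p) = inj₂ (trans p q , ≈-trans (≈-app ≈-refl t≈p) (≈-comp p q (trans p q) x₀))

mainTheorem3 : (n : ℕ) (Coe : Fin n → Fin n → Set) →
    IsTransitive Coe → IsAcyclic Coe → AtMostOne Coe →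
    let open System n Coe in
    ∀ {k : ℕ} (i j : Fin n) (C̃ : Tm k 1) →
    base i ≺ C̃ ∶ base j →
    ∀ (C : Tm k 1) → C̃ ⟶* C → Normal C →
    Compound i j C ×
    ((i ≡ j × C ≡ var zero) ⊎ Σ (Coe i j) (λ p → C ≈ con p · var zero))
mainTheorem3 n Coe trans _ _ i j C̃ d C C̃⟶*C normal = compound , Compound-collapse trans compound
  where
  open System n Coe
  open Coercions n Coe

  compound : Compound i j C
  compound = normal-CoeTm⇒Compound (CoeTm-⟶* (≺-between-bases d) C̃⟶*C) normal
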